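{- Consider online multi-coloring of paths with at least $10$ nodes. For any integer $b\ge 3$ and any $(1+\frac{1}{2^b})$-competitive online algorithm with advice $A$, there exists $N\in\mathbb{N}$ such that $A$ has advice complexity at least $b-2$ on input sequences of length at least $N$.
   Context: Online multi-coloring: a graph $G=(V,E)$ is known in advance. A sequence of $n$ requests arrives one at a time; each request names a node $v$, and must immediately and irrevocably be assigned a color (a positive integer) different from every color previously assigned to $v$ or to any neighbor of $v$. The cost $A(I)$ of an algorithm $A$ on input $I$ is the number of distinct colors used; $\mathrm{Opt}(I)$ is the minimum number of colors with which an offline algorithm can legally color all requests of $I$. Advice model: an all-powerful offline oracle that knows $I$ writes an infinite binary advice tape; the online algorithm may read bits from it, and its advice complexity is the maximum index of a bit read. An algorithm is $c$-competitive if there is a constant $\alpha$ such that $A(I)\le c\cdot\mathrm{Opt}(I)+\alpha$ for all inputs $I$. -}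

module Defs where

open import Data.Nat using (ℕ; zero; suc; _+_; _*_; _^_; _≤_; _⊔_)
open import Data.Nat.Properties using (_≟_)
open import Data.Fin using (Fin; toℕ)
open import Data.Bool using (Bool)
open import Data.List using (List; []; _∷_; _∷ʳ_; length; zip; deduplicate; foldr; map)
open import Data.List.Relation.Unary.AllPairs using (AllPairs)
open import Data.Product using (Σ; _×_; _,_; ∃; ∃-syntax)
open import Data.Sum using (_⊎_)
open import Relation.Binary.PropositionalEquality using (_≡_; _≢_)

PathAdj : {m : ℕ} → Fin m → Fin m → Set
PathAdj u v = suc (toℕ u) ≡ toℕ v ⊎ suc (toℕ v) ≡ toℕ u

Conflict : {m : ℕ} → Fin m → Fin m → Set
Conflict u v = u ≡ v ⊎ PathAdj u v

Legal : {m : ℕ} → List (Fin m) → List ℕ → Set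
Legal I cs = length cs ≡ length I
           × AllPairs (λ p q → Conflict (Data.Product.proj₁ p) (Data.Product.proj₁ q)
                              → Data.Product.proj₂ p ≢ Data.Product.proj₂ q)
                      (zip I cs)

numColors : List ℕ → ℕ
numColors cs = length (deduplicate _≟_ cs)

IsOpt : {m : ℕ} → List (Fin m) → ℕ → Set
IsOpt I k = (∃[ cs ] (Legal I cs × numColors cs ≡ k))
          × (∀ cs → Legal I cs → k ≤ numColors cs)

-- Advice tape: infinite binary string, bit i at index i (0-based here;
-- the paper's 1-based index of bit i is suc i).
Tape : Set
Tape = ℕ → Bool

data Action : Set where
  query : ℕ → Action
  color : ℕ → Action

-- A deterministic online algorithm with advice for the path on m nodes
-- (the graph is known in advance).  Its decision depends on the requests
-- seen so far (current request last) and the advice bits obtained so far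
-- (in query order).  Its own earlier colours are determined by these.
record OnlineAlg (m : ℕ) : Set where
  field
    act : List (Fin m) → List Bool → Action
open OnlineAlg public

-- Serving the current request: from (bits, queried indices) to final
-- (bits, queried indices) and the output colour.
data Serve {m : ℕ} (A : OnlineAlg m) (φ : Tape) (h : List (Fin m))
     : List Bool → List ℕ → List Bool → List ℕ → ℕ → Set where
  stop : ∀ {β qs c} → act A h β ≡ color c → Serve A φ h β qs β qs c
  ask  : ∀ {β qs β' qs' c i} → act A h β ≡ query i
       → Serve A φ h (β ∷ʳ φ i) (qs ∷ʳ i) β' qs' c
       → Serve A φ h β qs β' qs' c

-- Run A φ I β qs cs : running A with advice tape φ on request sequence I
-- reads bits β at indices qs and outputs colours cs.
data Run {m : ℕ} (A : OnlineAlg m) (φ : Tape)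
     : List (Fin m) → List Bool → List ℕ → List ℕ → Set where
  start : Run A φ [] [] [] []
  next  : ∀ {I β qs cs v β' qs' c}
        → Run A φ I β qs cs
        → Serve A φ (I ∷ʳ v) β qs β' qs' c
        → Run A φ (I ∷ʳ v) β' qs' (cs ∷ʳ c)

-- maximum (1-based) index of an advice bit read (0 if none read)
maxIndex : List ℕ → ℕ
maxIndex qs = foldr _⊔_ 0 (map suc qs)

-- (A, O) is (1 + 1/2^b)-competitive: there is a constant α with
-- A(I) ≤ (1 + 1/2^b)·Opt(I) + α for all I, multiplied through by 2^b.
-- (A real additive constant can w.l.o.g. be replaced by a natural one.)
-- Moreover the run with the oracle's advice terminates and is legal.
Competitive : {m : ℕ} → ℕ → OnlineAlg m → (List (Fin m) → Tape) → Set
Competitive {m} b A O =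
  ∃[ α ] ∀ (I : List (Fin m)) →
    ∃[ β ] ∃[ qs ] ∃[ cs ] (Run A (O I) I β qs cs × Legal I cs
      × (∀ k → IsOpt I k → 2 ^ b * numColors cs ≤ (2 ^ b + 1) * k + 2 ^ b * α))

module Submission where

-- Write b = 3 + B and K = 2^B.  For every length n ≥ 4K(4α + 4) the adversary takes
-- d = ⌊n / 4K⌋, k = K·d and the K + 1 inputs
--     0^k 3^k 1^j 2^j (padding),   j = 0, d, 2d, ..., K·d,
-- on nodes of the path, padded at isolated nodes to length n; each has optimum k + j.
-- All of them start with the same prefix 0^k 3^k.  If no run reads an advice bit of
-- index ≥ B, pigeonhole gives two inputs (j < j′ = j + e, e ≥ d) with equal first B
-- bits; determinism makes both runs colour the prefix identically.  Counting shared and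
-- unshared prefix colours, the two runs together use ≥ 2k + 2j′ colours, which the two
-- competitive bounds forbid since e > 4α (lemma competitive-gap).

open import Function using (_∘_)
open import Data.Bool using (Bool; true; false)
open import Data.Empty using (⊥; ⊥-elim)
open import Data.Nat using (ℕ; zero; suc; _+_; _*_; _∸_; _^_; _⊓_; _≤_; _<_; _≤?_; z≤n; s≤s; z<s; s≤s⁻¹; NonZero)
open import Data.Nat.Properties
open import Data.Nat.DivMod using (_/_; _%_; m≡m%n+[m/n]*n; m%n<n; m*n/n≡m; /-monoˡ-≤; m/n*n≤m)
open import Data.Nat.ListAction using (sum)
open import Data.Nat.Tactic.RingSolver using (solve-∀)
open import Data.Fin using (Fin; #_; toℕ; fromℕ<)
import Data.Fin.Properties as Fin
open import Data.Fin.Properties using (toℕ-fromℕ<; toℕ<n; pigeonhole; any?)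
open import Data.List using (List; []; _∷_; _++_; _∷ʳ_; [_]; _∷ʳ′_; initLast; length; map; concat; concatMap; zip; replicate; take; drop; filter; applyUpTo)
open import Data.List.Properties using (length-++; length-replicate; length-take; length-drop; length-upTo; length-applyUpTo; take++drop≡id; ++-assoc; ++-identityʳ; ∷-injective; ∷ʳ-injective; ++-conicalˡ; ++-conicalʳ)
open import Data.List.Relation.Unary.All using (All; []; _∷_)
import Data.List.Relation.Unary.All as All
import Data.List.Relation.Unary.All.Properties as All
open import Data.List.Relation.Unary.AllPairs using (AllPairs; []; _∷_)
import Data.List.Relation.Unary.AllPairs as AllPairs
import Data.List.Relation.Unary.AllPairs.Properties as AllPairs
open import Data.List.Relation.Unary.Any using (here; there)
open import Data.List.Relation.Binary.Pointwise using (Pointwise; []; _∷_)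
open import Data.List.Membership.Propositional using (_∈_)
open import Data.List.Membership.Propositional.Properties using (∈-∃++; ∈-++⁻; ∈-++⁺ˡ; ∈-++⁺ʳ; ∈-filter⁻; ∈-deduplicate⁺; ∈-deduplicate⁻; ∈-upTo⁺; ∈-applyUpTo⁻)
open import Data.List.Membership.DecPropositional _≟_ using (_∈?_)
open import Data.List.Relation.Binary.Subset.Propositional using (_⊆_)
open import Data.List.Relation.Binary.Disjoint.Propositional using (Disjoint)
import Data.List.Relation.Binary.Disjoint.Propositional.Properties as Disjoint
open import Data.List.Relation.Unary.Unique.Propositional using (Unique)
import Data.List.Relation.Unary.Unique.Propositional.Properties as Unique
open import Data.List.Relation.Unary.Unique.DecPropositional.Properties _≟_ using (deduplicate-!)
open import Data.Product using (_×_; _,_; proj₁; proj₂; ∃-syntax; Σ-syntax)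
open import Data.Sum using (inj₁; inj₂)
open import Relation.Nullary using (yes; no; contradiction)
open import Relation.Nullary.Decidable using (_⊎-dec_; False; toWitnessFalse)
open import Relation.Binary using (Decidable)
import Relation.Unary as U
open import Relation.Unary.Properties using (∁?)
open import Relation.Binary.PropositionalEquality hiding ([_])
open import Defs

module _ {a} {A : Set a} where

  unique-⊆⇒length≤ : ∀ {xs ys : List A} → Unique xs → xs ⊆ ys → length xs ≤ length ys
  unique-⊆⇒length≤ {[]} _ _ = z≤n
  unique-⊆⇒length≤ {x ∷ xs} (x∉xs ∷ unique-xs) x∷xs⊆ys
    with ys₁ , ys₂ , refl ← ∈-∃++ (x∷xs⊆ys (here refl)) = begin
      suc (length xs)              ≤⟨ s≤s (unique-⊆⇒length≤ unique-xs xs⊆ys₁++ys₂) ⟩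
      suc (length (ys₁ ++ ys₂))    ≡⟨ cong suc (length-++ ys₁) ⟩
      suc (length ys₁ + length ys₂) ≡⟨ +-suc (length ys₁) (length ys₂) ⟨
      length ys₁ + length (x ∷ ys₂) ≡⟨ length-++ ys₁ ⟨
      length (ys₁ ++ x ∷ ys₂)      ∎
    where
    open ≤-Reasoning
    xs⊆ys₁++ys₂ : xs ⊆ ys₁ ++ ys₂
    xs⊆ys₁++ys₂ {y} y∈xs with ∈-++⁻ ys₁ (x∷xs⊆ys (there y∈xs))
    ... | inj₁ y∈ys₁         = ∈-++⁺ˡ y∈ys₁
    ... | inj₂ (here y≡x)    = contradiction (sym y≡x) (All.lookup x∉xs y∈xs)
    ... | inj₂ (there y∈ys₂) = ∈-++⁺ʳ ys₁ y∈ys₂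

  length-filter+length-filter-∁ : ∀ {p} {P : U.Pred A p} (P? : U.Decidable P) xs →
    length (filter P? xs) + length (filter (∁? P?) xs) ≡ length xs
  length-filter+length-filter-∁ P? [] = refl
  length-filter+length-filter-∁ P? (x ∷ xs) with P? x
  ... | yes _ = cong suc (length-filter+length-filter-∁ P? xs)
  ... | no  _ = trans (+-suc _ _) (cong suc (length-filter+length-filter-∁ P? xs))

++-cancel-prefix : ∀ {a} {A : Set a} (xs ys : List A) {xs′ ys′ : List A} →
  length xs ≡ length ys → xs ++ xs′ ≡ ys ++ ys′ → xs ≡ ys
++-cancel-prefix []       []       _   _  = refl
++-cancel-prefix (x ∷ xs) (y ∷ ys) len eq with refl , eq′ ← ∷-injective eq =
  cong (x ∷_) (++-cancel-prefix xs ys (suc-injective len) eq′)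

module _ {a ℓ} {A : Set a} {R : A → A → Set ℓ} where

  AllPairs-++⁻ : ∀ xs {ys} → AllPairs R (xs ++ ys) →
    AllPairs R xs × AllPairs R ys × All (λ x → All (R x) ys) xs
  AllPairs-++⁻ []       pairs        = [] , pairs , []
  AllPairs-++⁻ (x ∷ xs) (x~ ∷ pairs) with AllPairs-++⁻ xs pairs
  ... | xs~ , ys~ , xs~ys = (All.++⁻ˡ xs x~ ∷ xs~) , ys~ , (All.++⁻ʳ xs x~ ∷ xs~ys)

  AllPairs-concat⁻ : ∀ xss → AllPairs R (concat xss) →
    All (AllPairs R) xss × AllPairs (λ xs ys → All (λ x → All (R x) ys) xs) xss
  AllPairs-concat⁻ []         []    = [] , []
  AllPairs-concat⁻ (xs ∷ xss) pairs with AllPairs-++⁻ xs pairs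
  ... | xs~ , rest~ , xs~rest with AllPairs-concat⁻ xss rest~
  ...   | inner , across =
    (xs~ ∷ inner) , (All.All-swap (All.map All.concat⁻ xs~rest) ∷ across)

numColors-≥ : ∀ {xs cs} → Unique xs → xs ⊆ cs → length xs ≤ numColors cs
numColors-≥ unique-xs xs⊆cs = unique-⊆⇒length≤ unique-xs (∈-deduplicate⁺ _≟_ ∘ xs⊆cs)

numColors-≤ : ∀ {M} cs → All (_< M) cs → numColors cs ≤ M
numColors-≤ {M} cs cs<M = subst (numColors cs ≤_) (length-upTo M)
  (unique-⊆⇒length≤ (deduplicate-! cs)
    (λ c∈ → ∈-upTo⁺ (All.lookup cs<M (∈-deduplicate⁻ _≟_ cs c∈))))

-- A colour of cB outside cA is new to L₁ beyond cA; a
-- colour of cB inside cA is new to L₂ beyond c₁, c₂.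
colour-count : ∀ {cA cB c₁ c₂ L₁ L₂} →
  Unique cA → Unique cB → Unique c₁ → Unique c₂ →
  Disjoint c₁ c₂ → Disjoint cA c₁ → Disjoint cB c₂ →
  cA ⊆ L₁ → cB ⊆ L₁ → cB ⊆ L₂ → c₁ ⊆ L₂ → c₂ ⊆ L₂ →
  length cA + length cB + (length c₁ + length c₂) ≤ numColors L₁ + numColors L₂
colour-count {cA} {cB} {c₁} {c₂} {L₁} {L₂} uA uB u₁ u₂ c₁#c₂ cA#c₁ cB#c₂ cA⊆L₁ cB⊆L₁ cB⊆L₂ c₁⊆L₂ c₂⊆L₂ =
  begin
    length cA + length cB + (length c₁ + length c₂)
      ≡⟨ cong (λ t → length cA + t + (length c₁ + length c₂)) (length-filter+length-filter-∁ (_∈? cA) cB) ⟨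
    length cA + (length shared + length fresh) + (length c₁ + length c₂)
      ≡⟨ rearrange (length cA) (length shared) (length fresh) (length c₁) (length c₂) ⟩
    (length cA + length fresh) + (length c₁ + (length c₂ + length shared))
      ≡⟨ cong₂ _+_ (length-++ cA) (trans (length-++ c₁) (cong (length c₁ +_) (length-++ c₂))) ⟨
    length (cA ++ fresh) + length (c₁ ++ c₂ ++ shared)
      ≤⟨ +-mono-≤ (numColors-≥ unique₁ ⊆L₁) (numColors-≥ unique₂ ⊆L₂) ⟩
    numColors L₁ + numColors L₂ ∎
  where
  open ≤-Reasoning
  shared fresh : List ℕ
  shared = filter (_∈? cA) cB
  fresh  = filter (∁? (_∈? cA)) cB
  fresh⊆cB : fresh ⊆ cB
  fresh⊆cB = proj₁ ∘ ∈-filter⁻ (∁? (_∈? cA)) {xs = cB}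
  fresh#cA : ∀ {c} → c ∈ fresh → c ∈ cA → ⊥
  fresh#cA = proj₂ ∘ ∈-filter⁻ (∁? (_∈? cA)) {xs = cB}
  shared⊆cB : shared ⊆ cB
  shared⊆cB = proj₁ ∘ ∈-filter⁻ (_∈? cA) {xs = cB}
  shared⊆cA : shared ⊆ cA
  shared⊆cA = proj₂ ∘ ∈-filter⁻ (_∈? cA) {xs = cB}
  rearrange : ∀ a s f x y → a + (s + f) + (x + y) ≡ (a + f) + (x + (y + s))
  rearrange = solve-∀
  unique₁ : Unique (cA ++ fresh)
  unique₁ = Unique.++⁺ uA (Unique.filter⁺ (∁? (_∈? cA)) {cB} uB)
    (λ (c∈cA , c∈fresh) → fresh#cA c∈fresh c∈cA)
  unique₂ : Unique (c₁ ++ c₂ ++ shared)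
  unique₂ = Unique.++⁺ u₁ (Unique.++⁺ u₂ (Unique.filter⁺ (_∈? cA) {cB} uB) c₂#shared) c₁#rest
    where
    c₂#shared : Disjoint c₂ shared
    c₂#shared (c∈c₂ , c∈shared) = cB#c₂ (shared⊆cB c∈shared , c∈c₂)
    c₁#rest : Disjoint c₁ (c₂ ++ shared)
    c₁#rest {c} (c∈c₁ , c∈rest) with ∈-++⁻ c₂ c∈rest
    ... | inj₁ c∈c₂     = c₁#c₂ (c∈c₁ , c∈c₂)
    ... | inj₂ c∈shared = cA#c₁ (shared⊆cA c∈shared , c∈c₁)
  ⊆L₁ : cA ++ fresh ⊆ L₁
  ⊆L₁ c∈ with ∈-++⁻ cA c∈
  ... | inj₁ c∈cA    = cA⊆L₁ c∈cA
  ... | inj₂ c∈fresh = cB⊆L₁ (fresh⊆cB c∈fresh)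
  ⊆L₂ : c₁ ++ c₂ ++ shared ⊆ L₂
  ⊆L₂ c∈ with ∈-++⁻ c₁ c∈
  ... | inj₁ c∈c₁ = c₁⊆L₂ c∈c₁
  ... | inj₂ c∈rest with ∈-++⁻ c₂ c∈rest
  ...   | inj₁ c∈c₂     = c₂⊆L₂ c∈c₂
  ...   | inj₂ c∈shared = cB⊆L₂ (shared⊆cB c∈shared)

-- Inputs made of blocks of equal consecutive requests.  Legality of a colouring of
-- such an input reduces to two block-level facts: each block uses distinct colours,
-- and conflicting blocks use disjoint colour sets.
module _ {m : ℕ} where

  Compatible : Fin m × ℕ → Fin m × ℕ → Set
  Compatible p q = Conflict (proj₁ p) (proj₁ q) → proj₂ p ≢ proj₂ q

  -- A block (v , X): node v requested |X| times in a row, its requests coloured by X.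
  Block : Set
  Block = Fin m × List ℕ

  expand : List (Fin m × ℕ) → List (Fin m)
  expand []             = []
  expand ((v , n) ∷ ns) = replicate n v ++ expand ns

  colours : List Block → List ℕ
  colours = concatMap proj₂

  -- The blocks bs colour the request sequence expand ns, block by block.
  Shaped : List (Fin m × ℕ) → List Block → Set
  Shaped = Pointwise (λ n b → proj₁ n ≡ proj₁ b × proj₂ n ≡ length (proj₂ b))

  tagged : Block → List (Fin m × ℕ)
  tagged (v , X) = map (λ (x : ℕ) → v , x) X

  BlocksCompatible : Block → Block → Set
  BlocksCompatible (v , X) (w , Y) = Conflict v w → Disjoint X Y

  zip-++ : ∀ (I : List (Fin m)) {J} (X : List ℕ) {Y} → length I ≡ length X →
    zip (I ++ J) (X ++ Y) ≡ zip I X ++ zip J Y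
  zip-++ []      []      _  = refl
  zip-++ (v ∷ I) (x ∷ X) eq = cong ((v , x) ∷_) (zip-++ I X (suc-injective eq))

  zip-replicate : ∀ (v : Fin m) X → zip (replicate (length X) v) X ≡ map (λ (x : ℕ) → v , x) X
  zip-replicate v []      = refl
  zip-replicate v (x ∷ X) = cong ((v , x) ∷_) (zip-replicate v X)

  zip-blocks : ∀ {ns bs} → Shaped ns bs → zip (expand ns) (colours bs) ≡ concatMap tagged bs
  zip-blocks [] = refl
  zip-blocks {_ ∷ ns} {(v , X) ∷ bs} ((refl , refl) ∷ shaped) = begin
    zip (replicate (length X) v ++ expand ns) (X ++ colours bs)
      ≡⟨ zip-++ (replicate (length X) v) X (length-replicate (length X)) ⟩
    zip (replicate (length X) v) X ++ zip (expand ns) (colours bs)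
      ≡⟨ cong₂ _++_ (zip-replicate v X) (zip-blocks shaped) ⟩
    tagged (v , X) ++ concatMap tagged bs ∎
    where open ≡-Reasoning

  length-blocks : ∀ {ns bs} → Shaped ns bs → length (colours bs) ≡ length (expand ns)
  length-blocks [] = refl
  length-blocks {_ ∷ ns} {(v , X) ∷ bs} ((refl , refl) ∷ shaped) = begin
    length (X ++ colours bs)
      ≡⟨ length-++ X ⟩
    length X + length (colours bs)
      ≡⟨ cong₂ _+_ (sym (length-replicate (length X))) (length-blocks shaped) ⟩
    length (replicate (length X) v) + length (expand ns)
      ≡⟨ length-++ (replicate (length X) v) ⟨
    length (replicate (length X) v ++ expand ns) ∎
    where open ≡-Reasoning

  -- Inside a block all requests conflict, so its entries are compatible iff its
  -- colours are pairwise distinct.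
  tagged-compatible⁻ : ∀ b → AllPairs Compatible (tagged b) → Unique (proj₂ b)
  tagged-compatible⁻ (v , X) compatible =
    AllPairs.map (λ differ → differ (inj₁ refl)) (AllPairs.map⁻ compatible)

  tagged-compatible⁺ : ∀ b → Unique (proj₂ b) → AllPairs Compatible (tagged b)
  tagged-compatible⁺ (v , X) unique = AllPairs.map⁺ (AllPairs.map (λ x≢y _ → x≢y) unique)

  Across : Block → Block → Set
  Across b b′ = All (λ p → All (Compatible p) (tagged b′)) (tagged b)

  across⁻ : ∀ b b′ → Across b b′ → BlocksCompatible b b′
  across⁻ (v , X) (w , Y) across conflict (x∈X , x∈Y) =
    All.lookup (All.map⁻ (All.lookup (All.map⁻ across) x∈X)) x∈Y conflict refl

  across⁺ : ∀ b b′ → BlocksCompatible b b′ → Across b b′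
  across⁺ (v , X) (w , Y) compatible = All.map⁺ (All.tabulate λ x∈X →
    All.map⁺ (All.tabulate λ y∈Y conflict x≡y →
      compatible conflict (x∈X , subst (_∈ Y) (sym x≡y) y∈Y)))

  legal-blocks⁻ : ∀ {ns bs} → Shaped ns bs → Legal (expand ns) (colours bs) →
    All (Unique ∘ proj₂) bs × AllPairs BlocksCompatible bs
  legal-blocks⁻ {bs = bs} shaped (_ , compatible)
    with inner , across ← AllPairs-concat⁻ (map tagged bs) (subst (AllPairs Compatible) (zip-blocks shaped) compatible) =
    All.map (λ {b} → tagged-compatible⁻ b) (All.map⁻ inner) ,
    AllPairs.map (λ {b} {b′} → across⁻ b b′) (AllPairs.map⁻ across)

  legal-blocks⁺ : ∀ {ns bs} → Shaped ns bs → All (Unique ∘ proj₂) bs → AllPairs BlocksCompatible bs →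
    Legal (expand ns) (colours bs)
  legal-blocks⁺ {bs = bs} shaped unique compatible = length-blocks shaped ,
    subst (AllPairs Compatible) (sym (zip-blocks shaped))
      (AllPairs.concat⁺ (All.map⁺ (All.map (λ {b} → tagged-compatible⁺ b) unique))
                        (AllPairs.map⁺ (AllPairs.map (λ {b} {b′} → across⁺ b b′) compatible)))

  split-colouring : ∀ ns cs → length cs ≡ length (expand ns) →
    ∃[ bs ] (Shaped ns bs × colours bs ≡ cs)
  split-colouring []             []  _  = [] , [] , refl
  split-colouring ((v , n) ∷ ns) cs eq = extend (split-colouring ns (drop n cs) length-drop-n)
    where
    length-cs : length cs ≡ n + length (expand ns)
    length-cs = trans eq (trans (length-++ (replicate n v)) (cong (_+ length (expand ns)) (length-replicate n)))
    length-take-n : length (take n cs) ≡ n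
    length-take-n = trans (length-take n cs) (m≤n⇒m⊓n≡m (subst (n ≤_) (sym length-cs) (m≤m+n n _)))
    length-drop-n : length (drop n cs) ≡ length (expand ns)
    length-drop-n = trans (length-drop n cs) (trans (cong (_∸ n) length-cs) (m+n∸m≡n n _))
    extend : ∃[ bs ] (Shaped ns bs × colours bs ≡ drop n cs) →
      ∃[ bs ] (Shaped ((v , n) ∷ ns) bs × colours bs ≡ cs)
    extend (bs , shaped , colours≡) =
      (v , take n cs) ∷ bs , (refl , sym length-take-n) ∷ shaped ,
      trans (cong (take n cs ++_) colours≡) (take++drop≡id n cs)

  length-expand : ∀ ns → length (expand ns) ≡ sum (map proj₂ ns)
  length-expand []             = refl
  length-expand ((v , n) ∷ ns) =
    trans (length-++ (replicate n v)) (cong₂ _+_ (length-replicate n) (length-expand ns))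

AgreeBelow : ℕ → Tape → Tape → Set
AgreeBelow B φ ψ = ∀ i → i < B → φ i ≡ ψ i

module Runs {m : ℕ} (A : OnlineAlg m) where

  serve-extends : ∀ {φ h β qs β' qs' c} → Serve A φ h β qs β' qs' c → ∃[ δ ] qs' ≡ qs ++ δ
  serve-extends (stop _) = [] , sym (++-identityʳ _)
  serve-extends {qs = qs} (ask {i = i} _ serve) with δ , refl ← serve-extends serve =
    i ∷ δ , ++-assoc qs [ i ] δ

  run-length : ∀ {φ I β qs cs} → Run A φ I β qs cs → length cs ≡ length I
  run-length start = refl
  run-length (next {I = I} {cs = cs} run _) =
    trans (length-++ cs) (trans (cong (_+ 1) (run-length run)) (sym (length-++ I)))

  run-prefix : ∀ {φ} P Q {L β qs cs} → L ≡ P ++ Q → Run A φ L β qs cs →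
    ∃[ β₀ ] ∃[ qs₀ ] ∃[ cs₀ ] ∃[ δq ] ∃[ δc ]
      (Run A φ P β₀ qs₀ cs₀ × qs ≡ qs₀ ++ δq × cs ≡ cs₀ ++ δc)
  run-prefix P Q L≡ start with refl ← ++-conicalˡ P Q (sym L≡) =
    [] , [] , [] , [] , [] , start , refl , refl
  run-prefix P Q L≡ (next {I = I} {β' = β'} {qs' = qs'} {c = c} run serve) with initLast Q
  ... | [] = β' , qs' , _ , [] , [] ,
    subst (λ J → Run A _ J β' qs' _) (trans L≡ (++-identityʳ P)) (next run serve) ,
    sym (++-identityʳ _) , sym (++-identityʳ _)
  ... | Q′ ∷ʳ′ v
    with refl , refl ← ∷ʳ-injective I (P ++ Q′) (trans L≡ (sym (++-assoc P Q′ [ v ])))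
    with β₀ , qs₀ , cs₀ , δq , δc , run₀ , refl , refl ← run-prefix P Q′ refl run
    with δ , refl ← serve-extends serve =
    β₀ , qs₀ , cs₀ , δq ++ δ , δc ∷ʳ c , run₀ , ++-assoc qs₀ δq δ , ++-assoc cs₀ δc [ c ]

  serve-deterministic : ∀ {B φ ψ h β β′ qs β₁ qs₁ c₁ β₂ qs₂ c₂} → AgreeBelow B φ ψ → β ≡ β′ →
    Serve A φ h β qs β₁ qs₁ c₁ → Serve A ψ h β′ qs β₂ qs₂ c₂ → All (_< B) qs₁ →
    β₁ ≡ β₂ × qs₁ ≡ qs₂ × c₁ ≡ c₂
  serve-deterministic agree refl (stop act≡c₁) (stop act≡c₂) _
    with refl ← trans (sym act≡c₁) act≡c₂ = refl , refl , refl
  serve-deterministic agree refl (stop act≡c) (ask act≡q _) _ with () ← trans (sym act≡c) act≡q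
  serve-deterministic agree refl (ask act≡q _) (stop act≡c) _ with () ← trans (sym act≡c) act≡q
  serve-deterministic {qs = qs} agree refl (ask {i = i} act≡i serve₁) (ask act≡i′ serve₂) qs₁<B
    with refl ← trans (sym act≡i) act≡i′
    with δ , refl ← serve-extends serve₁ =
    serve-deterministic agree (cong (_ ∷ʳ_) (agree i (All.lookup qs₁<B (∈-++⁺ˡ (∈-++⁺ʳ qs (here refl))))))
      serve₁ serve₂ qs₁<B

  run-deterministic : ∀ {B φ ψ I J β₁ qs₁ cs₁ β₂ qs₂ cs₂} → AgreeBelow B φ ψ → I ≡ J →
    Run A φ I β₁ qs₁ cs₁ → Run A ψ J β₂ qs₂ cs₂ → All (_< B) qs₁ →
    β₁ ≡ β₂ × qs₁ ≡ qs₂ × cs₁ ≡ cs₂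
  run-deterministic agree I≡J start start _ = refl , refl , refl
  run-deterministic agree I≡J start (next {I = J} _ _) _ with () ← ++-conicalʳ J _ (sym I≡J)
  run-deterministic agree I≡J (next {I = I} _ _) start _ with () ← ++-conicalʳ I _ I≡J
  run-deterministic agree I≡J (next {I = I} {qs = qs} run₁ serve₁) (next {I = J} run₂ serve₂) qs₁<B
    with refl , refl ← ∷ʳ-injective I J I≡J
    with δ , refl ← serve-extends serve₁
    with refl , refl , refl ← run-deterministic agree refl run₁ run₂ (All.++⁻ˡ qs qs₁<B)
    with refl , refl , refl ← serve-deterministic agree refl serve₁ serve₂ qs₁<B =
    refl , refl , refl

-- The first B advice bits, read as a number below 2^B, for the pigeonhole principle.

digit : Bool → ℕ → ℕ
digit false N = 0
digit true  N = N

prefixValue : ℕ → Tape → ℕ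
prefixValue zero    φ = 0
prefixValue (suc B) φ = digit (φ B) (2 ^ B) + prefixValue B φ

prefixValue-< : ∀ B φ → prefixValue B φ < 2 ^ B
prefixValue-< zero    φ = s≤s z≤n
prefixValue-< (suc B) φ with φ B
... | false = ≤-trans (prefixValue-< B φ) (m≤m+n (2 ^ B) (2 ^ B + 0))
... | true  = subst (2 ^ B + prefixValue B φ <_) (cong (2 ^ B +_) (sym (+-identityʳ (2 ^ B))))
                (+-monoʳ-< (2 ^ B) (prefixValue-< B φ))

leading-digit : ∀ a b N x y → x < N → y < N → digit a N + x ≡ digit b N + y → a ≡ b × x ≡ y
leading-digit false false N x y _ _ x≡y = refl , x≡y
leading-digit true  true  N x y _ _ eq  = refl , +-cancelˡ-≡ N x y eq
leading-digit true  false N x y _ y<N eq = contradiction (subst (N ≤_) eq (m≤m+n N x)) (<⇒≱ y<N)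
leading-digit false true  N x y x<N _ eq = contradiction (subst (N ≤_) (sym eq) (m≤m+n N y)) (<⇒≱ x<N)

prefixValue-injective : ∀ B φ ψ → prefixValue B φ ≡ prefixValue B ψ → AgreeBelow B φ ψ
prefixValue-injective (suc B) φ ψ eq i i<1+B
  with φB≡ψB , rest≡ ← leading-digit (φ B) (ψ B) (2 ^ B) _ _ (prefixValue-< B φ) (prefixValue-< B ψ) eq
  with m≤n⇒m<n∨m≡n (s≤s⁻¹ i<1+B)
... | inj₁ i<B  = prefixValue-injective B φ ψ rest≡ i i<B
... | inj₂ refl = φB≡ψB

interval : ℕ → ℕ → List ℕ
interval a n = applyUpTo (a +_) n

∈-interval⁻ : ∀ {a n x} → x ∈ interval a n → a ≤ x × x < a + n
∈-interval⁻ {a} x∈ with i , i<n , refl ← ∈-applyUpTo⁻ (a +_) x∈ = m≤m+n a i , +-monoʳ-< a i<n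

interval-unique : ∀ a n → Unique (interval a n)
interval-unique a n = Unique.applyUpTo⁺₁ (a +_) n (λ i<j _ → <⇒≢ (+-monoʳ-< a i<j))

interval-disjoint : ∀ {a n b n′} → a + n ≤ b → Disjoint (interval a n) (interval b n′)
interval-disjoint a+n≤b (x∈ , x∈′) =
  <⇒≱ (≤-trans (proj₂ (∈-interval⁻ x∈)) a+n≤b) (proj₁ (∈-interval⁻ x∈′))

interval-< : ∀ a n {M} → a + n ≤ M → All (_< M) (interval a n)
interval-< a n a+n≤M = All.tabulate λ x∈ → ≤-trans (proj₂ (∈-interval⁻ x∈)) a+n≤M

-- The path on 10 + r nodes; the lower-bound inputs only use the nodes 0,1,2,3,5,7,9.
module Path (r : ℕ) where

  Node : Set
  Node = Fin (10 + r)

  conflict? : Decidable (Conflict {10 + r})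
  conflict? u v = u Fin.≟ v ⊎-dec (suc (toℕ u) ≟ toℕ v ⊎-dec suc (toℕ v) ≟ toℕ u)

  -- Blocks at non-adjacent nodes never conflict (checked by computation).
  apart : ∀ {u v : Node} {nonadjacent : False (conflict? u v)} {X Y} → BlocksCompatible (u , X) (v , Y)
  apart {nonadjacent = nonadjacent} conflict = contradiction conflict (toWitnessFalse nonadjacent)

  -- Requests to the isolated nodes 5, 7, 9, each at most k times: they pad an input
  -- to a prescribed length without changing its optimum.
  record Padding (k : ℕ) : Set where
    constructor padding
    field
      p₅ p₇ p₉ : ℕ
      p₅≤k : p₅ ≤ k
      p₇≤k : p₇ ≤ k
      p₉≤k : p₉ ≤ k

    total : ℕ
    total = p₅ + (p₇ + p₉)

  open Padding public

  suffix-shape : ∀ {k} → ℕ → Padding k → List (Node × ℕ)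
  suffix-shape j p = (# 1 , j) ∷ (# 2 , j) ∷ (# 5 , p₅ p) ∷ (# 7 , p₇ p) ∷ (# 9 , p₉ p) ∷ []

  shape : ∀ k → ℕ → Padding k → List (Node × ℕ)
  shape k j p = (# 0 , k) ∷ (# 3 , k) ∷ suffix-shape j p

  hard : ∀ k → ℕ → Padding k → List Node
  hard k j p = expand (shape k j p)

  prefix : ℕ → List Node
  prefix k = replicate k (# 0) ++ replicate k (# 3)

  hard-prefix : ∀ k j p → hard k j p ≡ prefix k ++ expand (suffix-shape j p)
  hard-prefix k j p = sym (++-assoc (replicate k (# 0)) (replicate k (# 3)) _)

  record HardColouring (k j : ℕ) (cs : List ℕ) : Set where
    field
      cA cB c₁ c₂ rest : List ℕ
      split : cs ≡ cA ++ cB ++ c₁ ++ c₂ ++ rest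
      |cA|≡k : length cA ≡ k
      |cB|≡k : length cB ≡ k
      |c₁|≡j : length c₁ ≡ j
      |c₂|≡j : length c₂ ≡ j
      unique-cA : Unique cA
      unique-cB : Unique cB
      unique-c₁ : Unique c₁
      unique-c₂ : Unique c₂
      cA#c₁ : Disjoint cA c₁
      cB#c₂ : Disjoint cB c₂
      c₁#c₂ : Disjoint c₁ c₂

    cA++cB⊆cs : cA ++ cB ⊆ cs
    cA++cB⊆cs c∈ rewrite split with ∈-++⁻ cA c∈
    ... | inj₁ c∈cA = ∈-++⁺ˡ c∈cA
    ... | inj₂ c∈cB = ∈-++⁺ʳ cA (∈-++⁺ˡ c∈cB)

    c₁⊆cs : c₁ ⊆ cs
    c₁⊆cs c∈ rewrite split = ∈-++⁺ʳ cA (∈-++⁺ʳ cB (∈-++⁺ˡ c∈))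

    c₂⊆cs : c₂ ⊆ cs
    c₂⊆cs c∈ rewrite split = ∈-++⁺ʳ cA (∈-++⁺ʳ cB (∈-++⁺ʳ c₁ (∈-++⁺ˡ c∈)))

  opaque
    hard-colouring : ∀ {k j p cs} → Legal (hard k j p) cs → HardColouring k j cs
    hard-colouring {k} {j} {p} {cs} legal
      with bs , shaped , refl ← split-colouring (shape k j p) cs (proj₁ legal) =
      read-blocks shaped (legal-blocks⁻ shaped legal)
      where
      read-blocks : ∀ {bs} → Shaped (shape k j p) bs →
        All (Unique ∘ proj₂) bs × AllPairs BlocksCompatible bs → HardColouring k j (colours bs)
      read-blocks {(_ , cA) ∷ (_ , cB) ∷ (_ , c₁) ∷ (_ , c₂) ∷ pads}
        ((refl , lA) ∷ (refl , lB) ∷ (refl , l₁) ∷ (refl , l₂) ∷ _)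
        (uA ∷ uB ∷ u₁ ∷ u₂ ∷ _ , (_ ∷ A#1 ∷ _) ∷ (_ ∷ B#2 ∷ _) ∷ (1#2 ∷ _) ∷ _) = record
        { split = refl ; |cA|≡k = sym lA ; |cB|≡k = sym lB ; |c₁|≡j = sym l₁ ; |c₂|≡j = sym l₂
        ; unique-cA = uA ; unique-cB = uB ; unique-c₁ = u₁ ; unique-c₂ = u₂
        ; cA#c₁ = A#1 (inj₂ (inj₁ refl)) ; cB#c₂ = B#2 (inj₂ (inj₂ refl)) ; c₁#c₂ = 1#2 (inj₂ (inj₁ refl)) }

  -- Any legal colouring needs k + j colours: those at node 0 and at node 1 differ.
  hard-opt-≥ : ∀ {k j p} cs → Legal (hard k j p) cs → k + j ≤ numColors cs
  hard-opt-≥ {k} {j} {p} cs legal = subst (_≤ numColors cs) |cA++c₁|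
    (numColors-≥ (Unique.++⁺ unique-cA unique-c₁ cA#c₁) cA++c₁⊆cs)
    where
    open HardColouring (hard-colouring {k} {j} {p} legal)
    |cA++c₁| : length (cA ++ c₁) ≡ k + j
    |cA++c₁| = trans (length-++ cA) (cong₂ _+_ |cA|≡k |c₁|≡j)
    cA++c₁⊆cs : cA ++ c₁ ⊆ cs
    cA++c₁⊆cs c∈ with ∈-++⁻ cA c∈
    ... | inj₁ c∈cA = cA++cB⊆cs (∈-++⁺ˡ c∈cA)
    ... | inj₂ c∈c₁ = c₁⊆cs c∈c₁

  optimal-blocks : ∀ k → ℕ → Padding k → List (Node × List ℕ)
  optimal-blocks k j p =
    (# 0 , interval 0 k) ∷ (# 3 , interval j k) ∷ (# 1 , interval k j) ∷ (# 2 , interval 0 j) ∷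
    (# 5 , interval 0 (p₅ p)) ∷ (# 7 , interval 0 (p₇ p)) ∷ (# 9 , interval 0 (p₉ p)) ∷ []

  optimal-legal : ∀ k j p → j ≤ k → Legal (hard k j p) (colours (optimal-blocks k j p))
  optimal-legal k j p j≤k = legal-blocks⁺ shaped
    (interval-unique 0 k ∷ interval-unique j k ∷ interval-unique k j ∷ interval-unique 0 j ∷
     interval-unique 0 (p₅ p) ∷ interval-unique 0 (p₇ p) ∷ interval-unique 0 (p₉ p) ∷ [])
    ((apart ∷ (λ _ → interval-disjoint ≤-refl) ∷ apart ∷ apart ∷ apart ∷ apart ∷ []) ∷
     (apart ∷ (λ _ → Disjoint.sym (interval-disjoint ≤-refl)) ∷ apart ∷ apart ∷ apart ∷ []) ∷
     ((λ _ → Disjoint.sym (interval-disjoint j≤k)) ∷ apart ∷ apart ∷ apart ∷ []) ∷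
     (apart ∷ apart ∷ apart ∷ []) ∷
     (apart ∷ apart ∷ []) ∷
     (apart ∷ []) ∷
     [] ∷ [])
    where
    fits : ∀ a n → n ≡ length (interval a n)
    fits a n = sym (length-applyUpTo (a +_) n)
    shaped : Shaped (shape k j p) (optimal-blocks k j p)
    shaped = (refl , fits 0 k) ∷ (refl , fits j k) ∷ (refl , fits k j) ∷ (refl , fits 0 j) ∷
             (refl , fits 0 (p₅ p)) ∷ (refl , fits 0 (p₇ p)) ∷ (refl , fits 0 (p₉ p)) ∷ []

  optimal-bounded : ∀ k j p → All (_< k + j) (colours (optimal-blocks k j p))
  optimal-bounded k j p =
    All.++⁺ (interval-< 0 k (m≤m+n k j)) (All.++⁺ (interval-< j k (≤-reflexive (+-comm j k)))
    (All.++⁺ (interval-< k j ≤-refl) (All.++⁺ (interval-< 0 j (m≤n+m j k))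
    (All.++⁺ (padding-< (p₅≤k p)) (All.++⁺ (padding-< (p₇≤k p)) (All.++⁺ (padding-< (p₉≤k p)) []))))))
    where
    padding-< : ∀ {q} → q ≤ k → All (_< k + j) (interval 0 q)
    padding-< {q} q≤k = interval-< 0 q (≤-trans q≤k (m≤m+n k j))

  hard-opt : ∀ k j p → j ≤ k → IsOpt (hard k j p) (k + j)
  hard-opt k j p j≤k =
    (colours (optimal-blocks k j p) , optimal-legal k j p j≤k ,
     ≤-antisym (numColors-≤ _ (optimal-bounded k j p)) (hard-opt-≥ {k} {j} {p} _ (optimal-legal k j p j≤k))) ,
    hard-opt-≥ {k} {j} {p}

  length-hard : ∀ k j p → length (hard k j p) ≡ k + k + (j + j) + total p
  length-hard k j p = trans (length-expand (shape k j p)) (rearrange k j (p₅ p) (p₇ p) (p₉ p))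
    where
    rearrange : ∀ k j a b c → k + (k + (j + (j + (a + (b + (c + 0)))))) ≡ k + k + (j + j) + (a + (b + c))
    rearrange = solve-∀

  spread-padding : ∀ k t → t ≤ k + k + k → Σ[ p ∈ Padding k ] total p ≡ t
  spread-padding k t t≤3k =
    padding (k ⊓ t) (k ⊓ (t ∸ k)) (t ∸ k ∸ k) (m⊓n≤m k t) (m⊓n≤m k (t ∸ k))
      (m≤n+o⇒m∸n≤o (t ∸ k) k (m≤n+o⇒m∸n≤o t k (≤-trans t≤3k (≤-reflexive (+-assoc k k k))))) ,
    trans (cong (k ⊓ t +_) (m⊓n+n∸m≡n k (t ∸ k))) (m⊓n+n∸m≡n k t)

-- Both runs cannot meet
-- the bound T ≤ (1 + 1/8K)·Opt + α: summed, the bounds leave room only for the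
-- additional e colours up to (2k + 2j + e)/8K + 2α ≤ e/2 + 2α, as k ≤ K·e; so e ≤ 4α.
competitive-gap : ∀ K α k j e T₁ T₂ → .{{NonZero K}} →
  4 * α < e → k ≤ K * e → j + e ≤ k →
  k + k + ((j + e) + (j + e)) ≤ T₁ + T₂ →
  8 * K * T₁ ≤ (8 * K + 1) * (k + j) + 8 * K * α →
  8 * K * T₂ ≤ (8 * K + 1) * (k + (j + e)) + 8 * K * α → ⊥
competitive-gap K α k j e T₁ T₂ 4α<e k≤Ke j+e≤k enough bound₁ bound₂ =
  contradiction e≤4α (<⇒≱ 4α<e)
  where
  open ≤-Reasoning
  W S : ℕ
  W = 8 * K
  S = k + k + j + j + e
  -- summing both competitive bounds
  We≤S+2Wα : W * e ≤ S + 2 * W * α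
  We≤S+2Wα = +-cancelˡ-≤ (W * S) _ _ (begin
    W * S + W * e                            ≡⟨ split-needed ⟩
    W * (k + k + ((j + e) + (j + e)))        ≤⟨ *-monoʳ-≤ W enough ⟩
    W * (T₁ + T₂)                            ≡⟨ *-distribˡ-+ W T₁ T₂ ⟩
    W * T₁ + W * T₂                          ≤⟨ +-mono-≤ bound₁ bound₂ ⟩
    (W + 1) * (k + j) + W * α + ((W + 1) * (k + (j + e)) + W * α)
                                             ≡⟨ collect-bounds ⟩
    W * S + (S + 2 * W * α)                  ∎)
    where
    split-needed : W * S + W * e ≡ W * (k + k + ((j + e) + (j + e)))
    split-needed = identity W k j e
      where
      identity : ∀ W k j e → W * (k + k + j + j + e) + W * e ≡ W * (k + k + ((j + e) + (j + e)))
      identity = solve-∀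
    collect-bounds : (W + 1) * (k + j) + W * α + ((W + 1) * (k + (j + e)) + W * α) ≡ W * S + (S + 2 * W * α)
    collect-bounds = identity W k j e α
      where
      identity : ∀ W k j e α → (W + 1) * (k + j) + W * α + ((W + 1) * (k + (j + e)) + W * α)
                               ≡ W * (k + k + j + j + e) + ((k + k + j + j + e) + 2 * W * α)
      identity = solve-∀
  S≤4Ke : S ≤ 4 * K * e
  S≤4Ke = begin
    S                             ≡⟨ identity k j e ⟩
    k + k + (j + (j + e))         ≤⟨ +-monoʳ-≤ (k + k) (+-mono-≤ (≤-trans (m≤m+n j e) j+e≤k) j+e≤k) ⟩
    k + k + (k + k)               ≤⟨ +-mono-≤ (+-mono-≤ k≤Ke k≤Ke) (+-mono-≤ k≤Ke k≤Ke) ⟩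
    K * e + K * e + (K * e + K * e) ≡⟨ four K e ⟩
    4 * K * e                     ∎
    where
    identity : ∀ k j e → k + k + j + j + e ≡ k + k + (j + (j + e))
    identity = solve-∀
    four : ∀ K e → K * e + K * e + (K * e + K * e) ≡ 4 * K * e
    four = solve-∀
  e≤4α : e ≤ 4 * α
  e≤4α = *-cancelˡ-≤ (4 * K) {{m*n≢0 4 K}} (+-cancelˡ-≤ (4 * K * e) _ _ (begin
    4 * K * e + 4 * K * e         ≡⟨ double K e ⟩
    W * e                         ≤⟨ We≤S+2Wα ⟩
    S + 2 * W * α                 ≤⟨ +-monoˡ-≤ (2 * W * α) S≤4Ke ⟩
    4 * K * e + 2 * W * α         ≡⟨ cong (4 * K * e +_) (regroup K α) ⟩
    4 * K * e + 4 * K * (4 * α)   ∎))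
    where
    double : ∀ K e → 4 * K * e + 4 * K * e ≡ 8 * K * e
    double = solve-∀
    regroup : ∀ K α → 2 * (8 * K) * α ≡ 4 * K * (4 * α)
    regroup = solve-∀

module Adversary {r : ℕ} (A : OnlineAlg (10 + r)) (O : List (Fin (10 + r)) → Tape) (B α : ℕ) where
  open Path r
  open Runs A

  K : ℕ
  K = 2 ^ B

  instance
    K≢0 : NonZero K
    K≢0 = m^n≢0 2 B

  WithinBound : List Node → List ℕ → Set
  WithinBound I cs = ∀ k → IsOpt I k → 2 ^ (3 + B) * numColors cs ≤ (2 ^ (3 + B) + 1) * k + 2 ^ (3 + B) * α

  within-bound-8K : ∀ {I cs k} → WithinBound I cs → IsOpt I k →
    8 * K * numColors cs ≤ (8 * K + 1) * k + 8 * K * α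
  within-bound-8K {cs = cs} {k} bound opt =
    subst (λ W → W * numColors cs ≤ (W + 1) * k + W * α) (^-distribˡ-+-* 2 3 B) (bound k opt)

  record BoundedRun (I : List Node) : Set where
    field
      bits : List Bool
      queries colouring : List ℕ
      run : Run A (O I) I bits queries colouring
      legal : Legal I colouring
      within : WithinBound I colouring

  indistinguishable : ∀ {k j j′ e} {p p′ : Padding k} → j + e ≡ j′ →
    4 * α < e → k ≤ K * e → j′ ≤ k →
    AgreeBelow B (O (hard k j p)) (O (hard k j′ p′)) →
    (R₁ : BoundedRun (hard k j p)) → All (_< B) (BoundedRun.queries R₁) →
    BoundedRun (hard k j′ p′) → ⊥
  indistinguishable {k} {j} {e = e} {p} {p′} refl 4α<e k≤Ke j′≤k agree
    record { run = run₁ ; within = within₁ } qs₁<B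
    record { run = run₂ ; legal = legal₂ ; within = within₂ }
    with _ , qs₀ , c₀ , _ , δ₁ , prefix-run₁ , refl , refl ← run-prefix (prefix k) _ (hard-prefix k j p) run₁
    with _ , _ , c₀′ , _ , δ₂ , prefix-run₂ , refl , refl ← run-prefix (prefix k) _ (hard-prefix k (j + e) p′) run₂ =
    competitive-gap K α k j e (numColors (c₀ ++ δ₁)) (numColors (c₀′ ++ δ₂)) 4α<e k≤Ke j′≤k
      (subst (_≤ numColors (c₀ ++ δ₁) + numColors (c₀′ ++ δ₂)) lengths
        (colour-count unique-cA unique-cB unique-c₁ unique-c₂ c₁#c₂ cA#c₁ cB#c₂
          (λ c∈ → prefix⊆cs₁ (∈-++⁺ˡ c∈)) (λ c∈ → prefix⊆cs₁ (∈-++⁺ʳ cA c∈))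
          (λ c∈ → cA++cB⊆cs (∈-++⁺ʳ cA c∈)) c₁⊆cs c₂⊆cs))
      (within-bound-8K {cs = c₀ ++ δ₁} within₁ (hard-opt k j p (≤-trans (m≤m+n j e) j′≤k)))
      (within-bound-8K {cs = c₀′ ++ δ₂} within₂ (hard-opt k (j + e) p′ j′≤k))
    where
    open HardColouring (hard-colouring {k} {j + e} {p′} legal₂)
    same-prefix : c₀′ ≡ c₀
    same-prefix = sym (proj₂ (proj₂ (run-deterministic agree refl prefix-run₁ prefix-run₂ (All.++⁻ˡ qs₀ qs₁<B))))
    |c₀′| : length c₀′ ≡ length (cA ++ cB)
    |c₀′| = begin
      length c₀′                        ≡⟨ run-length prefix-run₂ ⟩
      length (prefix k)                 ≡⟨ length-++ (replicate k _) ⟩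
      length (replicate k _) + length (replicate k _) ≡⟨ cong₂ _+_ (length-replicate k) (length-replicate k) ⟩
      k + k                             ≡⟨ cong₂ _+_ |cA|≡k |cB|≡k ⟨
      length cA + length cB             ≡⟨ length-++ cA ⟨
      length (cA ++ cB)                 ∎
      where open ≡-Reasoning
    prefix≡ : c₀ ≡ cA ++ cB
    prefix≡ = trans (sym same-prefix) (++-cancel-prefix c₀′ (cA ++ cB) |c₀′| (trans split (sym (++-assoc cA cB _))))
    prefix⊆cs₁ : cA ++ cB ⊆ c₀ ++ δ₁
    prefix⊆cs₁ c∈ = ∈-++⁺ˡ (subst (_ ∈_) (sym prefix≡) c∈)
    lengths : length cA + length cB + (length c₁ + length c₂) ≡ k + k + ((j + e) + (j + e))
    lengths = cong₂ _+_ (cong₂ _+_ |cA|≡k |cB|≡k) (cong₂ _+_ |c₁|≡j |c₂|≡j)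

maxIndex≤⇒below : ∀ B qs → maxIndex qs ≤ B → All (_< B) qs
maxIndex≤⇒below B []       _ = []
maxIndex≤⇒below B (q ∷ qs) ≤B =
  m⊔n≤o⇒m≤o (suc q) (maxIndex qs) ≤B ∷ maxIndex≤⇒below B qs (m⊔n≤o⇒n≤o (suc q) (maxIndex qs) ≤B)

module Family {r : ℕ} (A : OnlineAlg (10 + r)) (O : List (Fin (10 + r)) → Tape) (B α : ℕ) where
  open Path r
  open Adversary A O B α

  threshold : ℕ
  threshold = 4 * K * (4 * α + 4)

  instance
    4K≢0 : NonZero (4 * K)
    4K≢0 = m*n≢0 4 K

  module Inputs (competitive : ∀ I → BoundedRun I) (n : ℕ) (threshold≤n : threshold ≤ n) where

    d k : ℕ
    d = n / (4 * K)
    k = K * d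

    d-large : 4 * α + 4 ≤ d
    d-large = subst (_≤ d) (m*n/n≡m (4 * α + 4) (4 * K))
      (/-monoˡ-≤ (4 * K) (≤-trans (≤-reflexive (*-comm (4 * α + 4) (4 * K))) threshold≤n))

    4k≤n : k + k + (k + k) ≤ n
    4k≤n = ≤-trans (≤-reflexive (four-k K d)) (m/n*n≤m n (4 * K))
      where
      four-k : ∀ K d → K * d + K * d + (K * d + K * d) ≡ d * (4 * K)
      four-k = solve-∀

    n≤5k : n ≤ k + k + (k + k + k)
    n≤5k = begin
      n                          ≡⟨ m≡m%n+[m/n]*n n (4 * K) ⟩
      n % (4 * K) + d * (4 * K)  ≤⟨ +-monoˡ-≤ _ (<⇒≤ (m%n<n n (4 * K))) ⟩
      4 * K + d * (4 * K)        ≤⟨ +-monoˡ-≤ _ 4K≤k ⟩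
      k + d * (4 * K)            ≡⟨ five-k K d ⟩
      k + k + (k + k + k)        ∎
      where
      open ≤-Reasoning
      4K≤k : 4 * K ≤ k
      4K≤k = subst (_≤ k) (*-comm K 4) (*-monoʳ-≤ K (≤-trans (m≤n+m 4 (4 * α)) d-large))
      five-k : ∀ K d → K * d + d * (4 * K) ≡ K * d + K * d + (K * d + K * d + K * d)
      five-k = solve-∀

    j : Fin (suc K) → ℕ
    j i = toℕ i * d

    j≤k : ∀ i → j i ≤ k
    j≤k i = *-monoˡ-≤ d (s≤s⁻¹ (toℕ<n i))

    unpadded≤n : ∀ i → k + k + (j i + j i) ≤ n
    unpadded≤n i = ≤-trans (+-monoʳ-≤ (k + k) (+-mono-≤ (j≤k i) (j≤k i))) 4k≤n

    pad : ∀ i → Σ[ p ∈ Padding k ] total p ≡ n ∸ (k + k + (j i + j i))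
    pad i = spread-padding k _
      (≤-trans (∸-monoʳ-≤ n (m≤m+n (k + k) (j i + j i))) (m≤n+o⇒m∸n≤o n (k + k) n≤5k))

    input : Fin (suc K) → List Node
    input i = hard k (j i) (proj₁ (pad i))

    length-input : ∀ i → length (input i) ≡ n
    length-input i = begin-equality
      length (input i)                                ≡⟨ length-hard k (j i) (proj₁ (pad i)) ⟩
      k + k + (j i + j i) + total (proj₁ (pad i))     ≡⟨ cong (k + k + (j i + j i) +_) (proj₂ (pad i)) ⟩
      k + k + (j i + j i) + (n ∸ (k + k + (j i + j i))) ≡⟨ m+[n∸m]≡n (unpadded≤n i) ⟩
      n                                               ∎
      where open ≤-Reasoning

    advice : Fin (suc K) → Fin K
    advice i = fromℕ< (prefixValue-< B (O (input i)))

    -- Inputs i < i′ with equal first B advice bits contradict competitiveness when the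
    -- run on input i reads no other bit: they differ by e = (i′ - i)·d ≥ d > 4α.
    collide : ∀ {i i′} → toℕ i < toℕ i′ → advice i ≡ advice i′ →
      (All (_< B) (BoundedRun.queries (competitive (input i)))) → ⊥
    collide {i} {i′} i<i′ same below with o , i+1+o≡i′ ← m≤n⇒∃[o]m+o≡n i<i′ =
      indistinguishable {k} {j i} {j i′} {suc o * d} {proj₁ (pad i)} {proj₁ (pad i′)} j+e≡j′ 4α<e k≤Ke (j≤k i′) agree
        (competitive (input i)) below (competitive (input i′))
      where
      e≥d : d ≤ suc o * d
      e≥d = m≤m+n d (o * d)
      j+e≡j′ : j i + suc o * d ≡ j i′
      j+e≡j′ = trans (sym (*-distribʳ-+ d (toℕ i) (suc o))) (cong (_* d) (trans (+-suc (toℕ i) o) i+1+o≡i′))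
      4α<e : 4 * α < suc o * d
      4α<e = <-≤-trans (m<m+n (4 * α) z<s) (≤-trans d-large e≥d)
      k≤Ke : k ≤ K * (suc o * d)
      k≤Ke = *-monoʳ-≤ K e≥d
      agree : AgreeBelow B (O (input i)) (O (input i′))
      agree = prefixValue-injective B _ _
        (trans (sym (toℕ-fromℕ< (prefixValue-< B (O (input i)))))
          (trans (cong toℕ same) (toℕ-fromℕ< (prefixValue-< B (O (input i′))))))

    -- Some input of length n makes its run read an advice bit at index ≥ B: otherwise,
    -- by pigeonhole, two of the K + 1 inputs share their first B advice bits.
    far-reading : ∃[ i ] suc B ≤ maxIndex (BoundedRun.queries (competitive (input i)))
    far-reading with any? (λ i → suc B ≤? maxIndex (BoundedRun.queries (competitive (input i))))
    ... | yes found = found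
    ... | no none with i , i′ , i<i′ , same ← pigeonhole (n<1+n K) advice =
      ⊥-elim (collide i<i′ same (maxIndex≤⇒below B _ (s≤s⁻¹ (≰⇒> λ far → none (i , far)))))

    lower-bound : ∃[ I ] (length I ≡ n × ∃[ β ] ∃[ qs ] ∃[ cs ]
                    (Run A (O I) I β qs cs × suc B ≤ maxIndex qs))
    lower-bound with i , far ← far-reading =
      input i , length-input i , bits , queries , colouring , run , far
      where open BoundedRun (competitive (input i))

theorem2 : (m : ℕ) → 10 ≤ m → (b : ℕ) → 3 ≤ b
         → (A : OnlineAlg m) → (O : List (Fin m) → Tape)
         → Competitive b A O
         → ∃[ N ] ∀ n → N ≤ n
           → ∃[ I ] (length I ≡ n × ∃[ β ] ∃[ qs ] ∃[ cs ]
               (Run A (O I) I β qs cs × b ∸ 2 ≤ maxIndex qs))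
theorem2 m 10≤m b 3≤b A O (α , competitive)
  with r , refl ← m≤n⇒∃[o]m+o≡n 10≤m
  with B , refl ← m≤n⇒∃[o]m+o≡n 3≤b =
  threshold , Inputs.lower-bound bounded-run
  where
  open Family A O B α
  open Adversary A O B α using (BoundedRun)
  bounded-run : ∀ I → BoundedRun I
  bounded-run I with β , qs , cs , run , legal , within ← competitive I = record
    { bits = β ; queries = qs ; colouring = cs ; run = run ; legal = legal ; within = within }
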